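{- Let $r$ be a constant even integer dividing $n$ with $n/r$ even. The polynomial family $f_{\textsf{PRY}}=\prod_{b=1}^{n/r} f_{\sf RY}(B_b)$ is computable by an interval formula of size polynomial in $n$.
   Context: $X=\{x_1,\ldots,x_n\}$, $W=\{w_{i,\ell,j}\}$ auxiliary variables treated as field elements ($\mathbb{G}=\mathbb{F}(W)$). For $i\le j$ with $j-i+1$ even, $f_{i,i-1}=1$ and for even length $\ge 2$, $f_{i,j}=(1+x_ix_j)f_{i+1,j-1}+\sum_{\ell}w_{i,\ell,j}f_{i,\ell}f_{\ell+1,j}$, summing over $\ell$ with $i<\ell<j-1$ such that $[i,\ell],[\ell+1,j]$ have even positive length. $B_b=\{x_{(b-1)r+1},\ldots,x_{br}\}$ and $f_{\sf RY}(B_b)=f_{(b-1)r+1,br}$. For $i<j$, $X_{ij}=\{x_p:i\le p\le j\}$. An interval formula is an arithmetic formula (tree-shaped circuit with $+,\times$ gates, leaves labeled by variables or constants) such that every gate computes a polynomial in some $X_{ij}$ and for every product gate $h_1\times h_2$ the intervals corresponding to $h_1,h_2$ are non-overlapping. -}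

module Defs where

open import Level using (Level; _⊔_) renaming (suc to lsuc)
open import Data.Nat using (ℕ; zero; suc; _+_; _*_; _∸_; _≤_; _<_; NonZero)
open import Data.Nat.DivMod using (_/_)
open import Data.List using (List; []; _∷_; foldr; map; upTo)
open import Data.Product using (Σ; _×_; _,_; ∃)
open import Data.Sum using (_⊎_)
open import Relation.Nullary using (¬_)
open import Algebra.Bundles using (CommutativeRing)

IsFieldRing : ∀ {c ℓ} → CommutativeRing c ℓ → Set (c ⊔ ℓ)
IsFieldRing R =
  (¬ (1# ≈ 0#)) × (∀ x → ¬ (x ≈ 0#) → Σ Carrier λ y → (x *ᴿ y) ≈ 1#)
  where open CommutativeRing R renaming (_*_ to _*ᴿ_)

module Poly {c ℓ} (G : CommutativeRing c ℓ) where
  open CommutativeRing G using (0#; 1#; -_; _≈_) renaming (Carrier to K; _+_ to _+ᴷ_; _*_ to _*ᴷ_)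

  data Term : Set c where
    const : K → Term
    var   : ℕ → Term
    _⊕_   : Term → Term → Term
    _⊗_   : Term → Term → Term

  infixl 6 _⊕_
  infixl 7 _⊗_

  size : Term → ℕ
  size (const _) = 1
  size (var _)   = 1
  size (s ⊕ t)   = suc (size s + size t)
  size (s ⊗ t)   = suc (size s + size t)

  -- Equality of the polynomials computed: the least congruence making Term
  -- the free commutative G-algebra on the variables, i.e. G[x_0,x_1,...].
  infix 4 _≋_
  data _≋_ : Term → Term → Set (c ⊔ ℓ) where
    ≋-refl  : ∀ {s} → s ≋ s
    ≋-sym   : ∀ {s t} → s ≋ t → t ≋ s
    ≋-trans : ∀ {s t u} → s ≋ t → t ≋ u → s ≋ u
    ⊕-cong  : ∀ {s s' t t'} → s ≋ s' → t ≋ t' → s ⊕ t ≋ s' ⊕ t'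
    ⊗-cong  : ∀ {s s' t t'} → s ≋ s' → t ≋ t' → s ⊗ t ≋ s' ⊗ t'
    ⊕-assoc : ∀ s t u → (s ⊕ t) ⊕ u ≋ s ⊕ (t ⊕ u)
    ⊕-comm  : ∀ s t → s ⊕ t ≋ t ⊕ s
    ⊕-idˡ   : ∀ s → const 0# ⊕ s ≋ s
    ⊕-invˡ  : ∀ s → const (- 1#) ⊗ s ⊕ s ≋ const 0#
    ⊗-assoc : ∀ s t u → (s ⊗ t) ⊗ u ≋ s ⊗ (t ⊗ u)
    ⊗-comm  : ∀ s t → s ⊗ t ≋ t ⊗ s
    ⊗-idˡ   : ∀ s → const 1# ⊗ s ≋ s
    distribˡ : ∀ s t u → s ⊗ (t ⊕ u) ≋ s ⊗ t ⊕ s ⊗ u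
    const-≈ : ∀ {a b} → a ≈ b → const a ≋ const b
    const-+ : ∀ a b → const (a +ᴷ b) ≋ const a ⊕ const b
    const-* : ∀ a b → const (a *ᴷ b) ≋ const a ⊗ const b

  VarsIn : ℕ → ℕ → Term → Set
  VarsIn i j (const _) = Lift0
    where open import Data.Unit using () renaming (⊤ to Lift0)
  VarsIn i j (var p)   = (i ≤ p) × (p ≤ j)
  VarsIn i j (s ⊕ t)   = VarsIn i j s × VarsIn i j t
  VarsIn i j (s ⊗ t)   = VarsIn i j s × VarsIn i j t

  InPoly : ℕ → ℕ → Term → Set (c ⊔ ℓ)
  InPoly i j t = Σ Term λ s → VarsIn i j s × (s ≋ t)

  -- IntervalAnn i j t : an assignment of intervals to all gates of t, the
  -- root getting [i,j], such that each gate computes a polynomial in its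
  -- interval's variables and children of product gates get non-overlapping intervals.
  data IntervalAnn (i j : ℕ) : Term → Set (c ⊔ ℓ) where
    cstI : ∀ a → i ≤ j → InPoly i j (const a) → IntervalAnn i j (const a)
    varI : ∀ p → i ≤ j → InPoly i j (var p) → IntervalAnn i j (var p)
    addI : ∀ {s t i₁ j₁ i₂ j₂} → i ≤ j → InPoly i j (s ⊕ t) →
           IntervalAnn i₁ j₁ s → IntervalAnn i₂ j₂ t → IntervalAnn i j (s ⊕ t)
    mulI : ∀ {s t i₁ j₁ i₂ j₂} → i ≤ j → InPoly i j (s ⊗ t) →
           IntervalAnn i₁ j₁ s → IntervalAnn i₂ j₂ t →
           (j₁ < i₂) ⊎ (j₂ < i₁) → IntervalAnn i j (s ⊗ t)

  IsIntervalFormula : Term → Set (c ⊔ ℓ)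
  IsIntervalFormula t = Σ ℕ λ i → Σ ℕ λ j → IntervalAnn i j t

  sumT : List Term → Term
  sumT = foldr _⊕_ (const 0#)

  prodT : List Term → Term
  prodT = foldr _⊗_ (const 1#)

  module RY (w : ℕ → ℕ → ℕ → K) where
    -- fAux k i m = f_{i, i+2m-1} (valid whenever fuel k > m).
    --   f_{i,i-1} = 1
    --   f_{i,j} = (1 + x_i x_j) f_{i+1,j-1} + Σ_ℓ w_{i,ℓ,j} f_{i,ℓ} f_{ℓ+1,j}
    -- with j = i+2m+1 (half-length m+1), ℓ = i+2a+1 for a = 0..m-1,
    -- so [i,ℓ] has half-length a+1 and [ℓ+1,j] has half-length m-a.
    fAux : ℕ → ℕ → ℕ → Term
    fAux zero    i m       = const 1#
    fAux (suc k) i zero    = const 1#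
    fAux (suc k) i (suc m) =
      (const 1# ⊕ var i ⊗ var j) ⊗ fAux k (suc i) m
      ⊕ sumT (map (λ a → let l = i + 2 * a + 1 in
                         const (w i l j) ⊗ fAux k i (suc a) ⊗ fAux k (suc l) (m ∸ a))
                  (upTo m))
      where j = i + 2 * m + 1

    -- f_{i,j} for j - i + 1 = 2m
    f : ℕ → ℕ → Term
    f i m = fAux (suc m) i m

    -- f_PRY = ∏_{b=1}^{n/r} f_RY(B_b), f_RY(B_b) = f_{(b-1)r+1, br};
    -- here blocks indexed by b' = b-1 ∈ {0,…,n/r-1}; block b' is
    -- [b'r+1, b'r+r], of half-length r/2.
    fPRY : (n r : ℕ) → .{{NonZero r}} → Term
    fPRY n r = prodT (map (λ b' → f (b' * r + 1) (r / 2)) (upTo (n / r)))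

-- The only gate of the Raz–Yehudayoff recurrence whose children overlap is
-- (1 + x_i x_j) · f_{i+1,j-1}.  Expanding it as f_{i+1,j-1} + x_i · (f_{i+1,j-1} · x_j)
-- gives an equivalent formula for f_{i,j} in which every product gate separates
-- its factors: x_i before [i+1,j], f_{i+1,j-1} before x_j, and f_{i,ℓ} before
-- f_{ℓ+1,j}.  Its size depends only on j - i, so for constant r each block costs
-- a constant S, and the product of the n/r blocks, which lie on consecutive
-- intervals, is an interval formula of size at most (S + 1)(n + 1).
module Submission where

open import Defs
open import Level using (_⊔_)
open import Function using (_∘_; id)
open import Data.Nat using (ℕ; zero; suc; _+_; _*_; _∸_; _^_; _≤_; _<_; NonZero; z≤n; s≤s; s≤s⁻¹; >-nonZero⁻¹)
open import Data.Nat.Properties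
open import Data.Nat.Tactic.RingSolver using (solve-∀)
open import Data.Nat.Divisibility using (_∣_)
open import Data.Nat.DivMod using (_/_; m/n*n≡m; m*[n/m]≡n; m/n≤m)
open import Data.List using ([]; _∷_; map; upTo; length; applyUpTo)
open import Data.List.Properties using (length-applyUpTo; map-upTo)
open import Data.List.Relation.Unary.All using (All; []; _∷_)
open import Data.List.Relation.Unary.All.Properties using (map⁺; applyUpTo⁺₁; applyUpTo⁺₂)
open import Data.Product using (Σ; _×_; _,_; proj₁; proj₂)
open import Data.Sum using (inj₁; inj₂)
open import Data.Unit using (tt)
open import Relation.Binary.Bundles using (Setoid)
open import Relation.Binary.PropositionalEquality using (_≡_; refl; sym; cong; cong₂; subst; module ≡-Reasoning)
open import Algebra.Bundles using (CommutativeRing)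

+-2*suc : ∀ i m → i + 2 * suc m ≡ suc (i + 2 * m + 1)
+-2*suc = solve-∀

suc-+-2* : ∀ i m → suc i + 2 * m ≡ i + 2 * m + 1
suc-+-2* = solve-∀

split-end : ∀ i a d → suc (i + 2 * a + 1) + 2 * d ≡ i + 2 * suc (d + a)
split-end = solve-∀

+1+-comm : ∀ x r → x + 1 + r ≡ suc (r + x)
+1+-comm = solve-∀

module IntervalFormulas {c ℓ} (G : CommutativeRing c ℓ) where
  open Poly G
  open CommutativeRing G using (0#; 1#)

  ≋-setoid : Setoid c (c ⊔ ℓ)
  ≋-setoid = record
    { Carrier = Term ; _≈_ = _≋_
    ; isEquivalence = record { refl = ≋-refl ; sym = ≋-sym ; trans = ≋-trans } }

  sumT-map-cong : ∀ {A : Set} {ψ ψ' : A → Term} xs → (∀ x → ψ x ≋ ψ' x) →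
                  sumT (map ψ xs) ≋ sumT (map ψ' xs)
  sumT-map-cong []       eq = ≋-refl
  sumT-map-cong (x ∷ xs) eq = ⊕-cong (eq x) (sumT-map-cong xs eq)

  prodT-map-cong : ∀ {A : Set} {ψ ψ' : A → Term} xs → (∀ x → ψ x ≋ ψ' x) →
                   prodT (map ψ xs) ≋ prodT (map ψ' xs)
  prodT-map-cong []       eq = ≋-refl
  prodT-map-cong (x ∷ xs) eq = ⊗-cong (eq x) (prodT-map-cong xs eq)

  VarsIn-mono : ∀ {i i' j j'} t → i' ≤ i → j ≤ j' → VarsIn i j t → VarsIn i' j' t
  VarsIn-mono (const _) _    _    _           = tt
  VarsIn-mono (var _)   i'≤i j≤j' (i≤p , p≤j) = ≤-trans i'≤i i≤p , ≤-trans p≤j j≤j'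
  VarsIn-mono (s ⊕ t)   i'≤i j≤j' (vs , vt)   = VarsIn-mono s i'≤i j≤j' vs , VarsIn-mono t i'≤i j≤j' vt
  VarsIn-mono (s ⊗ t)   i'≤i j≤j' (vs , vt)   = VarsIn-mono s i'≤i j≤j' vs , VarsIn-mono t i'≤i j≤j' vt

  VarsIn⇒InPoly : ∀ {i j t} → VarsIn i j t → InPoly i j t
  VarsIn⇒InPoly {t = t} v = t , v , ≋-refl

  IntervalAnn⇒≤ : ∀ {i j t} → IntervalAnn i j t → i ≤ j
  IntervalAnn⇒≤ (cstI _ i≤j _)     = i≤j
  IntervalAnn⇒≤ (varI _ i≤j _)     = i≤j
  IntervalAnn⇒≤ (addI i≤j _ _ _)   = i≤j
  IntervalAnn⇒≤ (mulI i≤j _ _ _ _) = i≤j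

  var-ann : ∀ p → IntervalAnn p p (var p)
  var-ann p = varI p ≤-refl (VarsIn⇒InPoly (≤-refl , ≤-refl))

  sumT-vars : ∀ {i j ts} → All (VarsIn i j) ts → VarsIn i j (sumT ts)
  sumT-vars []       = tt
  sumT-vars (v ∷ vs) = v , sumT-vars vs

  sumT-ann : ∀ {i j ts} → i ≤ j → VarsIn i j (sumT ts) → All (IntervalAnn i j) ts →
             IntervalAnn i j (sumT ts)
  sumT-ann i≤j _         []       = cstI 0# i≤j (VarsIn⇒InPoly tt)
  sumT-ann i≤j (v , vs) (a ∷ as) = addI i≤j (VarsIn⇒InPoly (v , vs)) a (sumT-ann i≤j vs as)

  -- The constant is annotated with the junk interval just after [i,j].
  const-⊗-ann : ∀ {i j t} a → VarsIn i j t → IntervalAnn i j t → IntervalAnn i j (const a ⊗ t)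
  const-⊗-ann a v ann =
    mulI (IntervalAnn⇒≤ ann) (VarsIn⇒InPoly (tt , v))
      (cstI a ≤-refl (VarsIn⇒InPoly tt)) ann (inj₂ ≤-refl)

  -- The trailing constant 1 of the product gets the interval [e n + 1, e n + 1],
  -- which also covers n = 0.
  prodT-blocks : (e : ℕ → ℕ) (ψ : ℕ → Term) →
    (∀ b → VarsIn (suc (e b)) (e (suc b)) (ψ b)) →
    (∀ b → IntervalAnn (suc (e b)) (e (suc b)) (ψ b)) →
    ∀ n → VarsIn (suc (e 0)) (e n) (prodT (applyUpTo ψ n))
        × IntervalAnn (suc (e 0)) (suc (e n)) (prodT (applyUpTo ψ n))
  prodT-blocks e ψ vars anns zero = tt , cstI 1# ≤-refl (VarsIn⇒InPoly tt)
  prodT-blocks e ψ vars anns (suc n) =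
    all-vars ,
    mulI (m≤n⇒m≤1+n (≤-trans e₀<e₁ e₁≤eₙ))
      (VarsIn⇒InPoly (VarsIn-mono (prodT (applyUpTo ψ (suc n))) ≤-refl (n≤1+n _) all-vars))
      (anns 0) (proj₂ rest) (inj₁ ≤-refl)
    where
    rest = prodT-blocks (e ∘ suc) (ψ ∘ suc) (vars ∘ suc) (anns ∘ suc) n
    e₀<e₁ : e 0 < e 1
    e₀<e₁ = IntervalAnn⇒≤ (anns 0)
    e₁≤eₙ : e 1 ≤ e (suc n)
    e₁≤eₙ = s≤s⁻¹ (IntervalAnn⇒≤ (proj₂ rest))
    all-vars : VarsIn (suc (e 0)) (e (suc n)) (prodT (applyUpTo ψ (suc n)))
    all-vars = VarsIn-mono (ψ 0) ≤-refl e₁≤eₙ (vars 0)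
             , VarsIn-mono (prodT (applyUpTo (ψ ∘ suc) n)) (m≤n⇒m≤1+n e₀<e₁) ≤-refl (proj₁ rest)

  data SameShape : Term → Term → Set c where
    const : ∀ {a b} → SameShape (const a) (const b)
    var   : ∀ {p q} → SameShape (var p) (var q)
    _⊕_   : ∀ {s s' t t'} → SameShape s s' → SameShape t t' → SameShape (s ⊕ t) (s' ⊕ t')
    _⊗_   : ∀ {s s' t t'} → SameShape s s' → SameShape t t' → SameShape (s ⊗ t) (s' ⊗ t')

  size-SameShape : ∀ {s t} → SameShape s t → size s ≡ size t
  size-SameShape const   = refl
  size-SameShape var     = refl
  size-SameShape (s ⊕ t) = cong₂ (λ a b → suc (a + b)) (size-SameShape s) (size-SameShape t)
  size-SameShape (s ⊗ t) = cong₂ (λ a b → suc (a + b)) (size-SameShape s) (size-SameShape t)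

  sumT-map-SameShape : ∀ {A : Set} {ψ ψ' : A → Term} xs → (∀ x → SameShape (ψ x) (ψ' x)) →
                       SameShape (sumT (map ψ xs)) (sumT (map ψ' xs))
  sumT-map-SameShape []       sh = const
  sumT-map-SameShape (x ∷ xs) sh = sh x ⊕ sumT-map-SameShape xs sh

  size-prodT : ∀ {S} ts → All (λ t → size t ≤ S) ts → size (prodT ts) ≤ suc S * suc (length ts)
  size-prodT {S} []       []         = ≤-trans (s≤s z≤n) (≤-reflexive (sym (*-identityʳ (suc S))))
  size-prodT {S} (t ∷ ts) (st ∷ sts) = begin
    suc (size t) + size (prodT ts)  ≤⟨ +-mono-≤ (s≤s st) (size-prodT ts sts) ⟩
    suc S + suc S * suc (length ts) ≡⟨ *-suc (suc S) (suc (length ts)) ⟨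
    suc S * suc (length (t ∷ ts))   ∎
    where open ≤-Reasoning

  module IntervalRY (w : ℕ → ℕ → ℕ → CommutativeRing.Carrier G) where
    open RY w

    fᴵAux   : ℕ → ℕ → ℕ → Term
    fᴵSplit : ℕ → ℕ → ℕ → ℕ → Term
    fᴵAux zero    i m       = const 1#
    fᴵAux (suc k) i zero    = const 1#
    fᴵAux (suc k) i (suc m) =
      (fᴵAux k (suc i) m ⊕ var i ⊗ (fᴵAux k (suc i) m ⊗ var (i + 2 * m + 1)))
      ⊕ sumT (map (fᴵSplit k i m) (upTo m))
    fᴵSplit k i m a =
      const (w i l (i + 2 * m + 1)) ⊗ fᴵAux k i (suc a) ⊗ fᴵAux k (suc l) (m ∸ a)
      where l = i + 2 * a + 1

    factor : ∀ x y P → P ⊕ x ⊗ (P ⊗ y) ≋ (const 1# ⊕ x ⊗ y) ⊗ P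
    factor x y P = begin
      P ⊕ x ⊗ (P ⊗ y)             ≈⟨ ⊕-cong (⊗-idˡ P) (⊗-cong ≋-refl (⊗-comm y P)) ⟨
      const 1# ⊗ P ⊕ x ⊗ (y ⊗ P)  ≈⟨ ⊕-cong ≋-refl (⊗-assoc x y P) ⟨
      const 1# ⊗ P ⊕ (x ⊗ y) ⊗ P  ≈⟨ ⊕-cong (⊗-comm _ P) (⊗-comm _ P) ⟩
      P ⊗ const 1# ⊕ P ⊗ (x ⊗ y)  ≈⟨ distribˡ P _ _ ⟨
      P ⊗ (const 1# ⊕ x ⊗ y)      ≈⟨ ⊗-comm P _ ⟩
      (const 1# ⊕ x ⊗ y) ⊗ P      ∎
      where open import Relation.Binary.Reasoning.Setoid ≋-setoid

    fᴵAux≋fAux : ∀ k i m → fᴵAux k i m ≋ fAux k i m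
    fᴵAux≋fAux zero    i m       = ≋-refl
    fᴵAux≋fAux (suc k) i zero    = ≋-refl
    fᴵAux≋fAux (suc k) i (suc m) =
      ⊕-cong (≋-trans (factor (var i) (var (i + 2 * m + 1)) (fᴵAux k (suc i) m))
                      (⊗-cong ≋-refl (fᴵAux≋fAux k (suc i) m)))
             (sumT-map-cong (upTo m) λ a →
               ⊗-cong (⊗-cong ≋-refl (fᴵAux≋fAux k i (suc a))) (fᴵAux≋fAux k _ (m ∸ a)))

    fᴵAux-SameShape   : ∀ k i i' m → SameShape (fᴵAux k i m) (fᴵAux k i' m)
    fᴵSplit-SameShape : ∀ k i i' m a → SameShape (fᴵSplit k i m a) (fᴵSplit k i' m a)
    fᴵAux-SameShape zero    i i' m       = const
    fᴵAux-SameShape (suc k) i i' zero    = const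
    fᴵAux-SameShape (suc k) i i' (suc m) =
      (P ⊕ (var ⊗ (P ⊗ var))) ⊕ sumT-map-SameShape (upTo m) (fᴵSplit-SameShape k i i' m)
      where P = fᴵAux-SameShape k (suc i) (suc i') m
    fᴵSplit-SameShape k i i' m a =
      (const ⊗ fᴵAux-SameShape k i i' (suc a)) ⊗ fᴵAux-SameShape k _ _ (m ∸ a)

    module Expand {i m hi} (bound : i + 2 * suc m ≤ suc hi) where
      j = i + 2 * m + 1

      j≤hi : j ≤ hi
      j≤hi = s≤s⁻¹ (≤-trans (≤-reflexive (sym (+-2*suc i m))) bound)

      i≤j : i ≤ j
      i≤j = ≤-trans (m≤m+n i (2 * m)) (m≤m+n _ 1)

      suc-i≤j : suc i ≤ j
      suc-i≤j = ≤-trans (m≤m+n (suc i) (2 * m)) (≤-reflexive (suc-+-2* i m))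

      inner-bound : suc i + 2 * m ≤ suc hi
      inner-bound = ≤-trans (≤-reflexive (suc-+-2* i m)) (m≤n⇒m≤1+n j≤hi)

    module Split {i m a lo hi} (lo≤i : lo ≤ i) (bound : i + 2 * suc m ≤ suc hi) (a<m : a < m) where
      l = i + 2 * a + 1

      left-bound : i + 2 * suc a ≤ suc hi
      left-bound = ≤-trans (+-monoʳ-≤ i (*-monoʳ-≤ 2 (m≤n⇒m≤1+n a<m))) bound

      right-bound : suc l + 2 * (m ∸ a) ≤ suc hi
      right-bound = begin
        suc l + 2 * (m ∸ a)      ≡⟨ split-end i a (m ∸ a) ⟩
        i + 2 * suc (m ∸ a + a)  ≡⟨ cong (λ d → i + 2 * suc d) (m∸n+n≡m (<⇒≤ a<m)) ⟩
        i + 2 * suc m            ≤⟨ bound ⟩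
        suc hi                   ∎
        where open ≤-Reasoning

      i≤l : i ≤ l
      i≤l = ≤-trans (m≤m+n i (2 * a)) (m≤m+n _ 1)

      suc-l≤hi : suc l ≤ hi
      suc-l≤hi = begin
        suc l          ≡⟨ +-2*suc i a ⟨
        i + 2 * suc a  ≤⟨ +-monoʳ-≤ i (*-monoʳ-≤ 2 a<m) ⟩
        i + 2 * m      ≤⟨ m≤m+n _ 1 ⟩
        i + 2 * m + 1  ≤⟨ Expand.j≤hi bound ⟩
        hi             ∎
        where open ≤-Reasoning

      lo≤hi : lo ≤ hi
      lo≤hi = ≤-trans lo≤i (≤-trans i≤l (≤-trans (n≤1+n l) suc-l≤hi))

    fᴵAux-vars   : ∀ k i m {lo hi} → lo ≤ i → i + 2 * m ≤ suc hi → VarsIn lo hi (fᴵAux k i m)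
    fᴵSplit-vars : ∀ k i m a {lo hi} → lo ≤ i → i + 2 * suc m ≤ suc hi → a < m →
                   VarsIn lo hi (fᴵSplit k i m a)
    fᴵAux-vars zero    i m       _    _     = tt
    fᴵAux-vars (suc k) i zero    _    _     = tt
    fᴵAux-vars (suc k) i (suc m) lo≤i bound =
      (vP , (lo≤i , ≤-trans i≤j j≤hi) , vP , (≤-trans lo≤i i≤j , j≤hi)) ,
      sumT-vars (map⁺ (applyUpTo⁺₁ id m (fᴵSplit-vars k i m _ lo≤i bound)))
      where
      open Expand bound
      vP = fᴵAux-vars k (suc i) m (m≤n⇒m≤1+n lo≤i) inner-bound
    fᴵSplit-vars k i m a lo≤i bound a<m =
      (tt , fᴵAux-vars k i (suc a) lo≤i left-bound) ,
      fᴵAux-vars k (suc l) (m ∸ a) (≤-trans lo≤i (≤-trans i≤l (n≤1+n l))) right-bound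
      where open Split lo≤i bound a<m

    fᴵAux-ann   : ∀ k i m {lo hi} → lo ≤ i → i + 2 * m ≤ suc hi → lo ≤ hi →
                  IntervalAnn lo hi (fᴵAux k i m)
    fᴵSplit-ann : ∀ k i m a {lo hi} → lo ≤ i → i + 2 * suc m ≤ suc hi → a < m →
                  IntervalAnn lo hi (fᴵSplit k i m a)
    fᴵAux-ann zero    i m       _    _     lo≤hi = cstI 1# lo≤hi (VarsIn⇒InPoly tt)
    fᴵAux-ann (suc k) i zero    _    _     lo≤hi = cstI 1# lo≤hi (VarsIn⇒InPoly tt)
    fᴵAux-ann (suc k) i (suc m) lo≤i bound lo≤hi =
      addI lo≤hi (VarsIn⇒InPoly vars)
        (addI lo≤hi (VarsIn⇒InPoly (proj₁ vars))
          (fᴵAux-ann k (suc i) m (m≤n⇒m≤1+n lo≤i) inner-bound lo≤hi)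
          (mulI lo≤hi (VarsIn⇒InPoly (proj₂ (proj₁ vars))) (var-ann i) inner (inj₁ ≤-refl)))
        (sumT-ann lo≤hi (proj₂ vars) (map⁺ (applyUpTo⁺₁ id m (fᴵSplit-ann k i m _ lo≤i bound))))
      where
      open Expand bound
      vars = fᴵAux-vars (suc k) i (suc m) lo≤i bound
      -- f_{i+1,j-1} is annotated with [i, j-1], which is nonempty even when m = 0.
      inner : IntervalAnn (suc i) j (fᴵAux k (suc i) m ⊗ var j)
      inner =
        mulI suc-i≤j
          (VarsIn⇒InPoly (fᴵAux-vars k (suc i) m ≤-refl (m≤n⇒m≤1+n (≤-reflexive (suc-+-2* i m)))
                         , (suc-i≤j , ≤-refl)))
          (fᴵAux-ann k (suc i) m (n≤1+n i) ≤-refl (m≤m+n i (2 * m)))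
          (var-ann j) (inj₁ (≤-reflexive (suc-+-2* i m)))
    fᴵSplit-ann k i m a lo≤i bound a<m =
      mulI lo≤hi (VarsIn⇒InPoly (fᴵSplit-vars k i m a lo≤i bound a<m))
        (const-⊗-ann _ (fᴵAux-vars k i (suc a) ≤-refl left-exact)
                       (fᴵAux-ann k i (suc a) ≤-refl left-exact i≤l))
        (fᴵAux-ann k (suc l) (m ∸ a) ≤-refl right-bound suc-l≤hi)
        (inj₁ ≤-refl)
      where
      open Split lo≤i bound a<m
      left-exact : i + 2 * suc a ≤ suc l
      left-exact = ≤-reflexive (+-2*suc i a)

module ProductOfBlocks {c ℓ} (G : CommutativeRing c ℓ) (w : ℕ → ℕ → ℕ → CommutativeRing.Carrier G)
                       (r : ℕ) .{{_ : NonZero r}} (2∣r : 2 ∣ r) where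
  open Poly G
  open RY w
  open IntervalFormulas G
  open IntervalRY w

  m = r / 2

  block : ℕ → Term
  block b = fᴵAux (suc m) (b * r + 1) m

  blockSize : ℕ
  blockSize = size (fᴵAux (suc m) 0 m)

  block-lo≤i : ∀ b → suc (b * r) ≤ b * r + 1
  block-lo≤i b = ≤-reflexive (sym (+-comm (b * r) 1))

  block-bound : ∀ b → b * r + 1 + 2 * m ≤ suc (suc b * r)
  block-bound b = ≤-reflexive (begin
    b * r + 1 + 2 * m  ≡⟨ cong (b * r + 1 +_) (m*[n/m]≡n 2∣r) ⟩
    b * r + 1 + r      ≡⟨ +1+-comm (b * r) r ⟩
    suc (suc b * r)    ∎)
    where open ≡-Reasoning

  block-lo≤hi : ∀ b → suc (b * r) ≤ suc b * r
  block-lo≤hi b = +-monoˡ-≤ (b * r) (>-nonZero⁻¹ r)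

  blocks : ∀ N → VarsIn 1 (N * r) (prodT (applyUpTo block N))
               × IntervalAnn 1 (suc (N * r)) (prodT (applyUpTo block N))
  blocks = prodT-blocks (_* r) block
    (λ b → fᴵAux-vars (suc m) (b * r + 1) m (block-lo≤i b) (block-bound b))
    (λ b → fᴵAux-ann (suc m) (b * r + 1) m (block-lo≤i b) (block-bound b) (block-lo≤hi b))

  blocks≋fPRY : ∀ n → prodT (applyUpTo block (n / r)) ≋ fPRY n r
  blocks≋fPRY n = begin
    prodT (applyUpTo block N)  ≡⟨ cong prodT (map-upTo block N) ⟨
    prodT (map block (upTo N)) ≈⟨ prodT-map-cong (upTo N) (λ b → fᴵAux≋fAux (suc m) (b * r + 1) m) ⟩
    fPRY n r                   ∎
    where
    N = n / r
    open import Relation.Binary.Reasoning.Setoid ≋-setoid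

  size-blocks : ∀ N → size (prodT (applyUpTo block N)) ≤ suc blockSize * suc N
  size-blocks N = begin
    size (prodT (applyUpTo block N))                 ≤⟨ size-prodT (applyUpTo block N) (applyUpTo⁺₂ block N λ b →
                                                          ≤-reflexive (size-SameShape (fᴵAux-SameShape (suc m) (b * r + 1) 0 m))) ⟩
    suc blockSize * suc (length (applyUpTo block N)) ≡⟨ cong (λ k → suc blockSize * suc k) (length-applyUpTo block N) ⟩
    suc blockSize * suc N                            ∎
    where open ≤-Reasoning

mainTheorem13 : (r : ℕ) → .{{_ : NonZero r}} → 2 ∣ r →
    ∀ {c ℓ} (G : CommutativeRing c ℓ) → IsFieldRing G →
    (w : ℕ → ℕ → ℕ → CommutativeRing.Carrier G) →
    Σ ℕ λ C → Σ ℕ λ k → (n : ℕ) → r ∣ n → 2 ∣ (n / r) →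
    Σ (Poly.Term G) λ F →
      Poly.IsIntervalFormula G F × Poly.VarsIn G 1 n F ×
      Poly._≋_ G F (Poly.RY.fPRY G w n r) × Poly.size G F ≤ C * suc n ^ k
mainTheorem13 r 2∣r G _ w = suc blockSize , 1 , λ n r∣n _ →
  let N = n / r in
  prodT (applyUpTo block N) ,
  (1 , suc (N * r) , proj₂ (blocks N)) ,
  subst (λ t → VarsIn 1 t (prodT (applyUpTo block N))) (m/n*n≡m r∣n) (proj₁ (blocks N)) ,
  blocks≋fPRY n ,
  (begin
    size (prodT (applyUpTo block N)) ≤⟨ size-blocks N ⟩
    suc blockSize * suc N            ≤⟨ *-monoʳ-≤ (suc blockSize) (s≤s (m/n≤m n r)) ⟩
    suc blockSize * suc n            ≡⟨ cong (suc blockSize *_) (*-identityʳ (suc n)) ⟨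
    suc blockSize * suc n ^ 1        ∎)
  where
  open Poly G
  open ProductOfBlocks G w r 2∣r
  open ≤-Reasoning
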